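{- Let $q>2$ be a prime power, $n$ a positive integer and $F=\mathbb{F}_{q^{2n+1}}$. Let $\alpha=-1$ if $q$ is odd and let $\alpha$ be any element of $\mathbb{F}_q\setminus\{0,1\}$ if $q$ is even. Consider the projective space $\mathrm{PG}(4n+1,q)$ whose points are the $1$-dimensional $\mathbb{F}_q$-subspaces of the $\mathbb{F}_q$-vector space $F\times F$; write $P(a,b)$ for the point spanned by $(a,b)\ne(0,0)$. For $\omega\in F^*$ let $\mathcal{V}_\omega=\{P(x^2,\omega x^{q+1}):x\in F^*\}$. Then $\mathcal{V}_1\cup\mathcal{V}_\alpha$ is a cap, i.e. no three of its points are collinear.
   Context: Three points of the projective space are collinear iff spanning vectors of them are $\mathbb{F}_q$-linearly dependent. -}

module Defs where

open import Level using (Level; _⊔_)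
open import Data.Nat as ℕ using (ℕ; zero; suc)
open import Data.Nat.Primality using (Prime)
open import Data.Product using (Σ; ∃; _×_; _,_)
open import Data.Sum using (_⊎_)
open import Relation.Nullary using (¬_)
open import Algebra.Bundles using (CommutativeRing)

private variable c ℓ : Level

IsPrimePower : ℕ → Set
IsPrimePower q = Σ ℕ λ p → Σ ℕ λ k → Prime p × (1 ℕ.≤ k) × (q ≡ p ℕ.^ k)
  where open import Relation.Binary.PropositionalEquality using (_≡_)

module _ (F : CommutativeRing c ℓ) where
  open CommutativeRing F

  record IsField : Set (c ⊔ ℓ) where
    field
      0≉1 : ¬ (0# ≈ 1#)
      inverse : ∀ x → ¬ (x ≈ 0#) → ∃ λ y → (x * y) ≈ 1#

  pow : Carrier → ℕ → Carrier
  pow x zero = 1#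
  pow x (suc m) = x * pow x m

  -- membership in the subfield F_q of F = F_{q^{2n+1}}: the fixed points of x ↦ x^q
  InFq : ℕ → Carrier → Set ℓ
  InFq q x = pow x q ≈ x

  Vec2 : Set c
  Vec2 = Carrier × Carrier

  _≈₂_ : Vec2 → Vec2 → Set ℓ
  (a , b) ≈₂ (a' , b') = (a ≈ a') × (b ≈ b')

  _·₂_ : Carrier → Vec2 → Vec2
  λ′ ·₂ (a , b) = (λ′ * a , λ′ * b)

  _+₂_ : Vec2 → Vec2 → Vec2
  (a , b) +₂ (a' , b') = (a + a' , b + b')

  0₂ : Vec2
  0₂ = (0# , 0#)

  SamePoint : ℕ → Vec2 → Vec2 → Set (c ⊔ ℓ)
  SamePoint q v w = ∃ λ μ → InFq q μ × ¬ (μ ≈ 0#) × (v ≈₂ (μ ·₂ w))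

  -- the three vectors are F_q-linearly dependent (equivalently, the three
  -- points they span are collinear)
  FqDependent3 : ℕ → Vec2 → Vec2 → Vec2 → Set (c ⊔ ℓ)
  FqDependent3 q u v w =
    ∃ λ λ₁ → ∃ λ λ₂ → ∃ λ λ₃ →
      InFq q λ₁ × InFq q λ₂ × InFq q λ₃ ×
      ¬ ((λ₁ ≈ 0#) × (λ₂ ≈ 0#) × (λ₃ ≈ 0#)) ×
      (((λ₁ ·₂ u) +₂ (λ₂ ·₂ v)) +₂ (λ₃ ·₂ w)) ≈₂ 0₂

  vpt : ℕ → Carrier → Carrier → Vec2
  vpt q ω x = (pow x 2 , ω * pow x (q ℕ.+ 1))

-- Write σ x = x ^ q. Since the characteristic p divides q, σ is a field endomorphism, and
-- σ^(2n+1) = id by Fermat's little theorem in F; 𝔽_q is its fixed field. Points P(x², ω x^(q+1))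
-- that are pairwise distinct satisfy no relation with a zero coefficient, so in a relation
-- λ₁P₁ + λ₂P₂ + λ₃P₃ = 0 all λᵢ are nonzero and two weights agree, say ω₁ = ω₂ = ω. With
-- t = x₁/x₂, s = x₃/x₂ and U = λ₁t² + λ₂, P = λ₁ σ(t) t + λ₂, the two coordinates give
-- U = -λ₃s², σU = -λ₃σ(s)² and ωP = -ω₃λ₃σ(s)s, hence ω²P² = ω₃² U σU. Lagrange's identity
-- U σU - P² = λ₁λ₂(t - σt)² then shows σt = t as soon as ω₃² = ω², and then P₁ = t² P₂.
-- For odd q this holds because ω² = 1 for ω ∈ {1, -1}. For even q the identity becomes
-- ω₃² - ω² = K (1/U - σ(1/U)) with K ∈ 𝔽_q, and an element moved by σ by a translation in 𝔽_q
-- is fixed when σ has odd order in characteristic 2 (Artin–Schreier).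

module Submission where

open import Defs
open import Level using (_⊔_)
open import Algebra.Bundles using (CommutativeRing; CommutativeMonoid)
import Algebra.Properties.CommutativeMonoid.Sum
import Algebra.Properties.Semiring.Exp as Exp
import Algebra.Solver.Ring.AlmostCommutativeRing as ACR
open import Data.Empty using (⊥)
open import Data.Fin.Base using (Fin; zero; suc; fromℕ; inject₁)
import Data.Fin.Properties as Fin
open import Data.Fin.Permutation using (Permutation; permutation)
open import Data.Integer.Base as ℤ using (ℤ; +_; -[1+_]; _⊖_; _◃_; sign; ∣_∣)
import Data.Integer.Properties as ℤ
open import Data.Maybe.Base using (Maybe; just; nothing)
open import Data.Nat.Base as ℕ using (ℕ; zero; suc; _∸_; _<_; _!)
import Data.Nat.Properties as ℕ
open import Data.Nat.Combinatorics using (_C_; nCn≡1; nCk≡n!/k![n-k]!; k![n∸k]!∣n!)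
open import Data.Nat.Divisibility using (_∣_; _∣?_; divides; ∣1⇒≡1; ∣⇒≤; m∣m*n)
open import Data.Nat.DivMod using (m/n*n≡m)
open import Data.Nat.Primality using (Prime; prime; euclidsLemma; prime⇒nonTrivial; prime⇒irreducible; prime[2])
open import Data.Product.Base as Product using (_,_; proj₁; proj₂)
open import Data.Sign.Base as Sign using (Sign)
open import Data.Sum.Base as Sum using (_⊎_; inj₁; inj₂)
open import Data.Vec.Functional using (Vector; replicate; removeAt; init; tail)
open import Function.Base using (_∘_; id)
open import Function.Bundles using (Bijection)
open import Relation.Binary.Definitions using (Decidable)
open import Relation.Binary.PropositionalEquality as ≡ using (_≡_; _≢_)
open import Relation.Nullary using (¬_; Dec; yes; no; contradiction)
open import Relation.Nullary.Decidable using (map′)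

-- With ℤ as coefficient ring the solver can cancel terms like x - x, which it cannot
-- do with coefficients in R, whose equality is not decidable.
module IntegerCoefficientSolver {c ℓ} (R : CommutativeRing c ℓ) where
  open CommutativeRing R
  open import Algebra.Properties.Ring ring using (-‿involutive; -0#≈0#; -‿+-comm; -1*x≈-x)
  open import Algebra.Properties.Semiring.Mult semiring using (_×_; ×-homo-+; ×1-homo-*)
  open import Relation.Binary.Reasoning.Setoid setoid

  ⟦_⟧ℤ : ℤ → Carrier
  ⟦ + n ⟧ℤ = n × 1#
  ⟦ -[1+ n ] ⟧ℤ = - (suc n × 1#)

  ⟦_⟧ₛ : Sign → Carrier
  ⟦ Sign.+ ⟧ₛ = 1#
  ⟦ Sign.- ⟧ₛ = - 1#

  ⟦⟧ₛ-homo-* : ∀ s t → ⟦ s Sign.* t ⟧ₛ ≈ ⟦ s ⟧ₛ * ⟦ t ⟧ₛ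
  ⟦⟧ₛ-homo-* Sign.+ t = sym (*-identityˡ _)
  ⟦⟧ₛ-homo-* Sign.- Sign.+ = sym (*-identityʳ _)
  ⟦⟧ₛ-homo-* Sign.- Sign.- = sym (trans (-1*x≈-x (- 1#)) (-‿involutive 1#))

  ⟦◃⟧ : ∀ s n → ⟦ s ◃ n ⟧ℤ ≈ ⟦ s ⟧ₛ * (n × 1#)
  ⟦◃⟧ s zero = sym (zeroʳ _)
  ⟦◃⟧ Sign.+ (suc n) = sym (*-identityˡ _)
  ⟦◃⟧ Sign.- (suc n) = sym (-1*x≈-x _)

  ⟦⟧-signAbs : ∀ i → ⟦ i ⟧ℤ ≈ ⟦ sign i ⟧ₛ * (∣ i ∣ × 1#)
  ⟦⟧-signAbs (+ n) = trans (reflexive (≡.cong ⟦_⟧ℤ (≡.sym (ℤ.+◃n≡+n n)))) (⟦◃⟧ Sign.+ n)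
  ⟦⟧-signAbs -[1+ n ] = ⟦◃⟧ Sign.- (suc n)

  ⟦⟧-homo-* : ∀ i j → ⟦ i ℤ.* j ⟧ℤ ≈ ⟦ i ⟧ℤ * ⟦ j ⟧ℤ
  ⟦⟧-homo-* i j = begin
    ⟦ sign i Sign.* sign j ◃ ∣ i ∣ ℕ.* ∣ j ∣ ⟧ℤ         ≈⟨ ⟦◃⟧ (sign i Sign.* sign j) (∣ i ∣ ℕ.* ∣ j ∣) ⟩
    ⟦ sign i Sign.* sign j ⟧ₛ * ((∣ i ∣ ℕ.* ∣ j ∣) × 1#) ≈⟨ *-cong (⟦⟧ₛ-homo-* (sign i) (sign j)) (×1-homo-* ∣ i ∣ ∣ j ∣) ⟩
    (⟦ sign i ⟧ₛ * ⟦ sign j ⟧ₛ) * ((∣ i ∣ × 1#) * (∣ j ∣ × 1#)) ≈⟨ interchange _ _ _ _ ⟩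
    (⟦ sign i ⟧ₛ * (∣ i ∣ × 1#)) * (⟦ sign j ⟧ₛ * (∣ j ∣ × 1#)) ≈⟨ sym (*-cong (⟦⟧-signAbs i) (⟦⟧-signAbs j)) ⟩
    ⟦ i ⟧ℤ * ⟦ j ⟧ℤ ∎
    where
    interchange : ∀ a b x y → (a * b) * (x * y) ≈ (a * x) * (b * y)
    interchange a b x y = begin
      (a * b) * (x * y) ≈⟨ *-assoc a b _ ⟩
      a * (b * (x * y)) ≈⟨ *-congˡ (trans (sym (*-assoc b x y)) (trans (*-congʳ (*-comm b x)) (*-assoc x b y))) ⟩
      a * (x * (b * y)) ≈⟨ sym (*-assoc a x _) ⟩
      (a * x) * (b * y) ∎

  ⟦⊖⟧ : ∀ m n → ⟦ m ⊖ n ⟧ℤ ≈ m × 1# - n × 1#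
  ⟦⊖⟧ m zero = trans (sym (+-identityʳ _)) (+-congˡ (sym -0#≈0#))
  ⟦⊖⟧ zero (suc n) = sym (+-identityˡ _)
  ⟦⊖⟧ (suc m) (suc n) = begin
    ⟦ suc m ⊖ suc n ⟧ℤ                 ≈⟨ reflexive (≡.cong ⟦_⟧ℤ (ℤ.[1+m]⊖[1+n]≡m⊖n m n)) ⟩
    ⟦ m ⊖ n ⟧ℤ                         ≈⟨ ⟦⊖⟧ m n ⟩
    m × 1# - n × 1#                    ≈⟨ sym ([1+x]-[1+y]≈x-y (m × 1#) (n × 1#)) ⟩
    (1# + m × 1#) - (1# + n × 1#)      ∎
    where
    [1+x]-[1+y]≈x-y : ∀ x y → (1# + x) - (1# + y) ≈ x - y
    [1+x]-[1+y]≈x-y x y = begin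
      (1# + x) + - (1# + y)       ≈⟨ +-congˡ (sym (-‿+-comm 1# y)) ⟩
      (1# + x) + (- 1# + - y)     ≈⟨ +-congʳ (+-comm 1# x) ⟩
      (x + 1#) + (- 1# + - y)     ≈⟨ +-assoc x 1# _ ⟩
      x + (1# + (- 1# + - y))     ≈⟨ +-congˡ (sym (+-assoc 1# (- 1#) (- y))) ⟩
      x + ((1# + - 1#) + - y)     ≈⟨ +-congˡ (trans (+-congʳ (-‿inverseʳ 1#)) (+-identityˡ _)) ⟩
      x - y                       ∎

  ⟦⟧-homo-+ : ∀ i j → ⟦ i ℤ.+ j ⟧ℤ ≈ ⟦ i ⟧ℤ + ⟦ j ⟧ℤ
  ⟦⟧-homo-+ (+ m) (+ n) = ×-homo-+ 1# m n
  ⟦⟧-homo-+ (+ m) -[1+ n ] = ⟦⊖⟧ m (suc n)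
  ⟦⟧-homo-+ -[1+ m ] (+ n) = trans (⟦⊖⟧ n (suc m)) (+-comm _ _)
  ⟦⟧-homo-+ -[1+ m ] -[1+ n ] = begin
    - (suc (suc (m ℕ.+ n)) × 1#)        ≈⟨ -‿cong (reflexive (≡.cong (λ k → suc k × 1#) (≡.sym (ℕ.+-suc m n)))) ⟩
    - ((suc m ℕ.+ suc n) × 1#)          ≈⟨ -‿cong (×-homo-+ 1# (suc m) (suc n)) ⟩
    - (suc m × 1# + suc n × 1#)         ≈⟨ sym (-‿+-comm _ _) ⟩
    - (suc m × 1#) + - (suc n × 1#)     ∎

  ⟦⟧-homo-neg : ∀ i → ⟦ ℤ.- i ⟧ℤ ≈ - ⟦ i ⟧ℤ
  ⟦⟧-homo-neg (+ zero) = sym -0#≈0#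
  ⟦⟧-homo-neg (+ suc n) = refl
  ⟦⟧-homo-neg -[1+ n ] = sym (-‿involutive _)

  homomorphism : ℤ.+-*-rawRing ACR.-Raw-AlmostCommutative⟶ ACR.fromCommutativeRing R
  homomorphism = record
    { ⟦_⟧ = ⟦_⟧ℤ ; +-homo = ⟦⟧-homo-+ ; *-homo = ⟦⟧-homo-* ; -‿homo = ⟦⟧-homo-neg
    ; 0-homo = refl ; 1-homo = +-identityʳ 1# }

  coefficient-equality : ∀ i j → Maybe (⟦ i ⟧ℤ ≈ ⟦ j ⟧ℤ)
  coefficient-equality i j with i ℤ.≟ j
  ... | yes ≡.refl = just refl
  ... | no _ = nothing

  open import Algebra.Solver.Ring ℤ.+-*-rawRing (ACR.fromCommutativeRing R) homomorphism coefficient-equality public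

module FieldProperties {c ℓ} (F : CommutativeRing c ℓ) (isField : IsField F) where
  open CommutativeRing F
  open IsField isField
  open import Algebra.Properties.Semiring.Exp semiring using (_^_)
  open import Relation.Binary.Reasoning.Setoid setoid

  1≉0 : 1# ≉ 0#
  1≉0 = 0≉1 ∘ sym

  infix 8 _⁻¹⟨_⟩
  _⁻¹⟨_⟩ : ∀ x → x ≉ 0# → Carrier
  x ⁻¹⟨ x≉0 ⟩ = proj₁ (inverse x x≉0)

  *-inverseʳ : ∀ x (x≉0 : x ≉ 0#) → x * x ⁻¹⟨ x≉0 ⟩ ≈ 1#
  *-inverseʳ x x≉0 = proj₂ (inverse x x≉0)

  *-inverseˡ : ∀ x (x≉0 : x ≉ 0#) → x ⁻¹⟨ x≉0 ⟩ * x ≈ 1#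
  *-inverseˡ x x≉0 = trans (*-comm _ x) (*-inverseʳ x x≉0)

  *-cancelˡ : ∀ {x y z} → x ≉ 0# → x * y ≈ x * z → y ≈ z
  *-cancelˡ {x} {y} {z} x≉0 xy≈xz = begin
    y                          ≈⟨ *-identityˡ y ⟨
    1# * y                     ≈⟨ *-congʳ (*-inverseˡ x x≉0) ⟨
    (x ⁻¹⟨ x≉0 ⟩ * x) * y      ≈⟨ *-assoc _ x y ⟩
    x ⁻¹⟨ x≉0 ⟩ * (x * y)      ≈⟨ *-congˡ xy≈xz ⟩
    x ⁻¹⟨ x≉0 ⟩ * (x * z)      ≈⟨ *-assoc _ x z ⟨
    (x ⁻¹⟨ x≉0 ⟩ * x) * z      ≈⟨ *-congʳ (*-inverseˡ x x≉0) ⟩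
    1# * z                     ≈⟨ *-identityˡ z ⟩
    z                          ∎

  *-cancelʳ : ∀ {x y z} → x ≉ 0# → y * x ≈ z * x → y ≈ z
  *-cancelʳ x≉0 yx≈zx = *-cancelˡ x≉0 (trans (*-comm _ _) (trans yx≈zx (*-comm _ _)))

  xy≈0⇒y≈0 : ∀ {x y} → x ≉ 0# → x * y ≈ 0# → y ≈ 0#
  xy≈0⇒y≈0 x≉0 xy≈0 = *-cancelˡ x≉0 (trans xy≈0 (sym (zeroʳ _)))

  xy≈0⇒x≈0 : ∀ {x y} → y ≉ 0# → x * y ≈ 0# → x ≈ 0#
  xy≈0⇒x≈0 y≉0 xy≈0 = xy≈0⇒y≈0 y≉0 (trans (*-comm _ _) xy≈0)

  *-nonzero : ∀ {x y} → x ≉ 0# → y ≉ 0# → x * y ≉ 0#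
  *-nonzero x≉0 y≉0 = y≉0 ∘ xy≈0⇒y≈0 x≉0

  ^-nonzero : ∀ {x} → x ≉ 0# → ∀ n → x ^ n ≉ 0#
  ^-nonzero x≉0 zero = 1≉0
  ^-nonzero x≉0 (suc n) = *-nonzero x≉0 (^-nonzero x≉0 n)

  -x≈0⇒x≈0 : ∀ {x} → - x ≈ 0# → x ≈ 0#
  -x≈0⇒x≈0 {x} -x≈0 = trans (sym (-‿involutive x)) (trans (-‿cong -x≈0) -0#≈0#)
    where open import Algebra.Properties.Ring ring using (-‿involutive; -0#≈0#)

  -‿nonzero : ∀ {x} → x ≉ 0# → - x ≉ 0#
  -‿nonzero x≉0 = x≉0 ∘ -x≈0⇒x≈0

  ⁻¹-cong : ∀ {x y} (x≉0 : x ≉ 0#) (y≉0 : y ≉ 0#) → x ≈ y → x ⁻¹⟨ x≉0 ⟩ ≈ y ⁻¹⟨ y≉0 ⟩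
  ⁻¹-cong {x} {y} x≉0 y≉0 x≈y = *-cancelˡ x≉0 (trans (*-inverseʳ x x≉0) (sym (trans (*-congʳ x≈y) (*-inverseʳ y y≉0))))

  ⁻¹-nonzero : ∀ {x} (x≉0 : x ≉ 0#) → x ⁻¹⟨ x≉0 ⟩ ≉ 0#
  ⁻¹-nonzero {x} x≉0 x⁻¹≈0 = 1≉0 (trans (sym (*-inverseʳ x x≉0)) (trans (*-congˡ x⁻¹≈0) (zeroʳ x)))

module SumProperties {m ℓm} (M : CommutativeMonoid m ℓm) where
  open CommutativeMonoid M
  open import Algebra.Properties.CommutativeMonoid.Sum M
  open import Relation.Binary.Reasoning.Setoid setoid

  sum-agree-except : ∀ {n} (i : Fin n) (f g : Vector Carrier n) →
                     (∀ j → j ≢ i → f j ≈ g j) → sum f ∙ g i ≈ sum g ∙ f i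
  sum-agree-except {suc n} i f g f≈g = begin
    sum f ∙ g i                        ≈⟨ ∙-congʳ (sum-remove f) ⟩
    (f i ∙ sum (removeAt f i)) ∙ g i   ≈⟨ ∙-congʳ (∙-congˡ (sum-cong-≋ λ j → f≈g _ (Fin.punchInᵢ≢i i j))) ⟩
    (f i ∙ sum (removeAt g i)) ∙ g i   ≈⟨ comm _ _ ⟩
    g i ∙ (f i ∙ sum (removeAt g i))   ≈⟨ ∙-congˡ (comm _ _) ⟩
    g i ∙ (sum (removeAt g i) ∙ f i)   ≈⟨ assoc _ _ _ ⟨
    (g i ∙ sum (removeAt g i)) ∙ f i   ≈⟨ ∙-congʳ (sum-remove g) ⟨
    sum g ∙ f i                        ∎

module FiniteField {c ℓ} (F : CommutativeRing c ℓ) (isField : IsField F) {N : ℕ}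
  (enumeration : Bijection (≡.setoid (Fin N)) (CommutativeRing.setoid F)) where
  open CommutativeRing F hiding (zero)
  open FieldProperties F isField
  open import Algebra.Properties.Semiring.Exp semiring using (_^_; ^-congˡ)
  open import Algebra.Properties.Semiring.Mult semiring using (_×_; ×1-homo-*)
  open SumProperties *-commutativeMonoid renaming (sum-agree-except to ∏-agree-except)
  open import Relation.Binary.Reasoning.Setoid setoid
  open Bijection enumeration renaming (to to element; injective to element-injective)

  index : Carrier → Fin N
  index x = proj₁ (strictlySurjective x)

  element-index : ∀ x → element (index x) ≈ x
  element-index x = proj₂ (strictlySurjective x)

  index-cong : ∀ {x y} → x ≈ y → index x ≡ index y
  index-cong {x} {y} x≈y = element-injective (trans (element-index x) (trans x≈y (sym (element-index y))))

  index-element : ∀ i → index (element i) ≡ i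
  index-element i = element-injective (element-index (element i))

  infix 4 _≟_
  _≟_ : Decidable _≈_
  x ≟ y = map′ (λ eq → trans (sym (element-index x)) (trans (reflexive (≡.cong element eq)) (element-index y)))
               index-cong (index x Fin.≟ index y)

  module _ {m ℓm} (M : CommutativeMonoid m ℓm) where
    private module M = CommutativeMonoid M
    open import Algebra.Properties.CommutativeMonoid.Sum M

    sum-reindex : (f : Carrier → M.Carrier) → (∀ {x y} → x ≈ y → f x M.≈ f y) →
                  (g h : Carrier → Carrier) → (∀ {x y} → x ≈ y → g x ≈ g y) → (∀ {x y} → x ≈ y → h x ≈ h y) →
                  (∀ x → g (h x) ≈ x) → (∀ x → h (g x) ≈ x) →
                  sum (f ∘ element) M.≈ sum (f ∘ g ∘ element)
    sum-reindex f f-cong g h g-cong h-cong gh hg =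
      M.trans (sum-permute (f ∘ element) π) (sum-cong-≋ {N} (λ i → f-cong (element-index _)))
      where
      π : Permutation N N
      π = permutation (index ∘ g ∘ element) (index ∘ h ∘ element)
        (λ i → element-injective (trans (element-index _) (trans (g-cong (element-index _)) (gh _))))
        (λ i → element-injective (trans (element-index _) (trans (h-cong (element-index _)) (hg _))))

  private
    module Σ = Algebra.Properties.CommutativeMonoid.Sum +-commutativeMonoid
    module Π = Algebra.Properties.CommutativeMonoid.Sum *-commutativeMonoid
    open import Algebra.Properties.Ring ring using (+-identityʳ-unique)

  N×1≈0 : N × 1# ≈ 0#
  N×1≈0 = +-identityʳ-unique (Σ.sum element) (N × 1#) (begin
    Σ.sum element + N × 1#                     ≈⟨ +-congˡ (Σ.sum-replicate N) ⟨
    Σ.sum element + Σ.sum (replicate N 1#)     ≈⟨ Σ.∑-distrib-+ element (replicate N 1#) ⟨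
    Σ.sum (λ i → element i + 1#)               ≈⟨ sum-reindex +-commutativeMonoid id id
                                                    (_+ 1#) (_- 1#) +-congʳ +-congʳ shift-back shift-forth ⟨
    Σ.sum element                              ∎)
    where
    shift-back : ∀ x → (x - 1#) + 1# ≈ x
    shift-back x = trans (+-assoc x _ 1#) (trans (+-congˡ (-‿inverseˡ 1#)) (+-identityʳ x))
    shift-forth : ∀ x → (x + 1#) - 1# ≈ x
    shift-forth x = trans (+-assoc x 1# _) (trans (+-congˡ (-‿inverseʳ 1#)) (+-identityʳ x))

  -- 0 is replaced by 1 so that the product over all of F is nonzero.
  unit : Carrier → Carrier
  unit x with x ≟ 0#
  ... | yes _ = 1#
  ... | no  _ = x

  unit-zero : ∀ {x} → x ≈ 0# → unit x ≈ 1#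
  unit-zero {x} x≈0 with x ≟ 0#
  ... | yes _ = refl
  ... | no x≉0 = contradiction x≈0 x≉0

  unit-nonzero : ∀ {x} → x ≉ 0# → unit x ≈ x
  unit-nonzero {x} x≉0 with x ≟ 0#
  ... | yes x≈0 = contradiction x≈0 x≉0
  ... | no  _ = refl

  unit≉0 : ∀ x → unit x ≉ 0#
  unit≉0 x with x ≟ 0#
  ... | yes _ = 1≉0
  ... | no x≉0 = x≉0

  unit-cong : ∀ {x y} → x ≈ y → unit x ≈ unit y
  unit-cong {x} {y} x≈y with x ≟ 0#
  ... | yes x≈0 = sym (unit-zero (trans (sym x≈y) x≈0))
  ... | no x≉0 = trans x≈y (sym (unit-nonzero (x≉0 ∘ trans x≈y)))

  ∏-nonzero : ∀ {n} (t : Vector Carrier n) → (∀ i → t i ≉ 0#) → Π.sum t ≉ 0#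
  ∏-nonzero {zero} t t≉0 = 1≉0
  ∏-nonzero {suc n} t t≉0 = *-nonzero (t≉0 zero) (∏-nonzero (tail t) (t≉0 ∘ suc))

  0^n≈0 : ∀ n → .{{ℕ.NonZero n}} → 0# ^ n ≈ 0#
  0^n≈0 (suc n) = zeroˡ _

  -- y ↦ x y permutes F and fixes 0, so ∏ unit (x y) = ∏ unit y; and x^N ∏ unit y = ∏ x unit y
  -- differs from ∏ unit (x y) only in the factor at y = 0, which is x instead of 1.
  x^N≈x : ∀ x → x ^ N ≈ x
  x^N≈x x with x ≟ 0#
  ... | yes x≈0 = trans (^-congˡ N x≈0) (trans (0^n≈0 N {{Fin.nonZeroIndex (index 0#)}}) (sym x≈0))
  ... | no x≉0 = *-cancelʳ (∏-nonzero units (unit≉0 ∘ element)) (begin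
    x ^ N * Π.sum units                          ≈⟨ *-congʳ (Π.sum-replicate N) ⟨
    Π.sum (replicate N x) * Π.sum units          ≈⟨ Π.∑-distrib-+ (replicate N x) units ⟨
    Π.sum f                                      ≈⟨ *-identityʳ _ ⟨
    Π.sum f * 1#                                 ≈⟨ *-congˡ (unit-zero (trans (*-congˡ (element-index 0#)) (zeroʳ x))) ⟨
    Π.sum f * g i₀                               ≈⟨ ∏-agree-except i₀ f g f≈g ⟩
    Π.sum g * f i₀                               ≈⟨ *-cong (sym (sum-reindex *-commutativeMonoid unit unit-cong
                                                      (x *_) (x ⁻¹⟨ x≉0 ⟩ *_) *-congˡ *-congˡ undo redo)) f[i₀]≈x ⟩
    Π.sum units * x                              ≈⟨ *-comm _ x ⟩
    x * Π.sum units                              ∎)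
    where
    units f g : Vector Carrier N
    units i = unit (element i)
    f i = x * unit (element i)
    g i = unit (x * element i)
    i₀ = index 0#
    f≈g : ∀ j → j ≢ i₀ → f j ≈ g j
    f≈g j j≢i₀ = trans (*-congˡ (unit-nonzero e≉0)) (sym (unit-nonzero (*-nonzero x≉0 e≉0)))
      where
      e≉0 : element j ≉ 0#
      e≉0 e≈0 = j≢i₀ (≡.trans (≡.sym (index-element j)) (index-cong e≈0))
    f[i₀]≈x : f i₀ ≈ x
    f[i₀]≈x = trans (*-congˡ (unit-zero (element-index 0#))) (*-identityʳ x)
    undo : ∀ y → x * (x ⁻¹⟨ x≉0 ⟩ * y) ≈ y
    undo y = trans (sym (*-assoc _ _ y)) (trans (*-congʳ (*-inverseʳ x x≉0)) (*-identityˡ y))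
    redo : ∀ y → x ⁻¹⟨ x≉0 ⟩ * (x * y) ≈ y
    redo y = trans (sym (*-assoc _ _ y)) (trans (*-congʳ (*-inverseˡ x x≉0)) (*-identityˡ y))

  N≡pᵐ⇒p×1≈0 : ∀ {p} m → N ≡ p ℕ.^ m → p × 1# ≈ 0#
  N≡pᵐ⇒p×1≈0 {p} m N≡pᵐ with p × 1# ≟ 0#
  ... | yes p×1≈0 = p×1≈0
  ... | no p×1≉0 = contradiction (begin
    (p × 1#) ^ m        ≈⟨ ×1-homo-^ m ⟨
    (p ℕ.^ m) × 1#      ≡⟨ ≡.cong (_× 1#) N≡pᵐ ⟨
    N × 1#              ≈⟨ N×1≈0 ⟩
    0#                  ∎) (^-nonzero p×1≉0 m)
    where
    ×1-homo-^ : ∀ m → (p ℕ.^ m) × 1# ≈ (p × 1#) ^ m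
    ×1-homo-^ zero = +-identityʳ 1#
    ×1-homo-^ (suc m) = trans (×1-homo-* p (p ℕ.^ m)) (*-congˡ (×1-homo-^ m))

p∤m! : ∀ {p} → Prime p → ∀ {m} → m < p → ¬ p ∣ m !
p∤m! {p} p-prime {zero} _ p∣1 = ℕ.nonTrivial⇒≢1 {{prime⇒nonTrivial p-prime}} (∣1⇒≡1 p∣1)
p∤m! {p} p-prime {suc m} m<p p∣m! with euclidsLemma (suc m) (m !) p-prime p∣m!
... | inj₁ p∣1+m = ℕ.<⇒≱ m<p (∣⇒≤ p∣1+m)
... | inj₂ p∣m! = p∤m! p-prime (ℕ.<-trans (ℕ.n<1+n m) m<p) p∣m!

p∣pCk : ∀ {p} → Prime p → ∀ {k} → 0 < k → k < p → p ∣ p C k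
p∣pCk {p} p-prime {k} 0<k k<p with euclidsLemma (p C k) (k ! ℕ.* (p ∸ k) !) p-prime p∣product
  where
  instance _ = ℕ._!*_!≢0 k (p ∸ k)
  n∣n! : ∀ {n} → 0 < n → n ∣ n !
  n∣n! {suc n} _ = m∣m*n (n !)
  p∣product : p ∣ (p C k) ℕ.* (k ! ℕ.* (p ∸ k) !)
  p∣product = ≡.subst (p ∣_) (≡.sym (≡.trans (≡.cong (ℕ._* (k ! ℕ.* (p ∸ k) !)) (nCk≡n!/k![n-k]! (ℕ.<⇒≤ k<p)))
                                           (m/n*n≡m (k![n∸k]!∣n! (ℕ.<⇒≤ k<p))))) (n∣n! (ℕ.<-trans 0<k k<p))
... | inj₁ p∣pCk = p∣pCk
... | inj₂ p∣k![p-k]! with euclidsLemma (k !) ((p ∸ k) !) p-prime p∣k![p-k]!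
...   | inj₁ p∣k! = contradiction p∣k! (p∤m! p-prime k<p)
...   | inj₂ p∣[p-k]! = contradiction p∣[p-k]! (p∤m! p-prime (ℕ.∸-monoʳ-< 0<k (ℕ.<⇒≤ k<p)))

prime∣m^k⇒prime∣m : ∀ {p m} → Prime p → ∀ k → p ∣ m ℕ.^ k → p ∣ m
prime∣m^k⇒prime∣m p-prime zero p∣1 = contradiction (∣1⇒≡1 p∣1) (ℕ.nonTrivial⇒≢1 {{prime⇒nonTrivial p-prime}})
prime∣m^k⇒prime∣m {m = m} p-prime (suc k) p∣m^[1+k] with euclidsLemma m (m ℕ.^ k) p-prime p∣m^[1+k]
... | inj₁ p∣m = p∣m
... | inj₂ p∣m^k = prime∣m^k⇒prime∣m p-prime k p∣m^k

module Frobenius {c ℓ} (R : CommutativeRing c ℓ) where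
  open CommutativeRing R hiding (zero)
  open import Algebra.Properties.Semiring.Exp semiring using (_^_; ^-congʳ; ^-assocʳ; ^-congˡ)
  open import Algebra.Properties.Semiring.Mult semiring using (_×_; ×-assoc-*; ×-congˡ; ×-congʳ; ×-assocˡ)
  open import Algebra.Properties.Monoid.Sum +-monoid using (sum; sum-init-last; sum-cong-≋; sum-replicate-zero)
  open import Algebra.Properties.CommutativeSemiring.Binomial commutativeSemiring using (binomialTerm; theorem)
  open import Relation.Binary.Reasoning.Setoid setoid

  ×0≈0 : ∀ n → n × 0# ≈ 0#
  ×0≈0 zero = refl
  ×0≈0 (suc n) = trans (+-identityˡ _) (×0≈0 n)

  module _ {p} (p×1≈0 : p × 1# ≈ 0#) where

    ∣p⇒×≈0 : ∀ {n} → p ∣ n → ∀ x → n × x ≈ 0#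
    ∣p⇒×≈0 (divides m ≡.refl) x = begin
      (m ℕ.* p) × x        ≈⟨ ×-assocˡ x m p ⟨
      m × (p × x)          ≈⟨ ×-congʳ m (trans (×-assoc-* p 1# x) (×-congʳ p (*-identityˡ x))) ⟨
      m × ((p × 1#) * x)   ≈⟨ ×-congʳ m (trans (*-congʳ p×1≈0) (zeroˡ x)) ⟩
      m × 0#               ≈⟨ ×0≈0 m ⟩
      0#                   ∎

  sum-outer : ∀ m (t : Vector Carrier (suc (suc m))) → (∀ j → t (suc (inject₁ j)) ≈ 0#) →
              sum t ≈ t zero + t (fromℕ (suc m))
  sum-outer m t inner≈0 = begin
    t zero + sum (tail t)                            ≈⟨ +-congˡ (sum-init-last (tail t)) ⟩
    t zero + (sum (init (tail t)) + t (fromℕ (suc m))) ≈⟨ +-congˡ (+-congʳ (trans (sum-cong-≋ {m} inner≈0) (sum-replicate-zero m))) ⟩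
    t zero + (0# + t (fromℕ (suc m)))                ≈⟨ +-congˡ (+-identityˡ _) ⟩
    t zero + t (fromℕ (suc m))                       ∎

  ^p-distrib-+ : ∀ {p} → Prime p → p × 1# ≈ 0# → ∀ x y → (x + y) ^ p ≈ x ^ p + y ^ p
  ^p-distrib-+ {0} (prime {{()}} _)
  ^p-distrib-+ {1} (prime {{()}} _)
  ^p-distrib-+ {p@(suc (suc m))} p-prime p×1≈0 x y = begin
    (x + y) ^ p                                          ≈⟨ theorem p x y ⟩
    sum (binomialTerm x y p)                             ≈⟨ sum-outer (suc m) (binomialTerm x y p) inner≈0 ⟩
    binomialTerm x y p zero + binomialTerm x y p (fromℕ p) ≈⟨ +-cong first≈y^p (last≈x^p _ (Fin.toℕ-fromℕ p)) ⟩
    y ^ p + x ^ p                                        ≈⟨ +-comm _ _ ⟩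
    x ^ p + y ^ p                                        ∎
    where
    inner≈0 : ∀ j → binomialTerm x y p (suc (inject₁ j)) ≈ 0#
    inner≈0 j = ∣p⇒×≈0 p×1≈0 (p∣pCk p-prime ℕ.z<s (ℕ.s<s (≡.subst (_< suc m) (≡.sym (Fin.toℕ-inject₁ j)) (Fin.toℕ<n j)))) _
    first≈y^p : binomialTerm x y p zero ≈ y ^ p
    first≈y^p = trans (+-identityʳ _) (*-identityˡ _)
    last≈x^p : ∀ k → k ≡ p → (p C k) × (x ^ k * y ^ (p ∸ k)) ≈ x ^ p
    last≈x^p _ ≡.refl = begin
      (p C p) × (x ^ p * y ^ (p ∸ p)) ≈⟨ ×-congˡ (nCn≡1 p) ⟩
      1 × (x ^ p * y ^ (p ∸ p))       ≈⟨ +-identityʳ _ ⟩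
      x ^ p * y ^ (p ∸ p)             ≈⟨ *-congˡ (^-congʳ y (ℕ.n∸n≡0 p)) ⟩
      x ^ p * 1#                      ≈⟨ *-identityʳ _ ⟩
      x ^ p                           ∎

  ^pᵏ-distrib-+ : ∀ {p} → Prime p → p × 1# ≈ 0# → ∀ k x y → (x + y) ^ (p ℕ.^ k) ≈ x ^ (p ℕ.^ k) + y ^ (p ℕ.^ k)
  ^pᵏ-distrib-+ p-prime p×1≈0 zero x y = trans (*-identityʳ _) (+-cong (sym (*-identityʳ x)) (sym (*-identityʳ y)))
  ^pᵏ-distrib-+ {p} p-prime p×1≈0 (suc k) x y = begin
    (x + y) ^ (p ℕ.* p ℕ.^ k)                       ≈⟨ ^-assocʳ (x + y) p (p ℕ.^ k) ⟨
    ((x + y) ^ p) ^ (p ℕ.^ k)                       ≈⟨ ^-congˡ (p ℕ.^ k) (^p-distrib-+ p-prime p×1≈0 x y) ⟩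
    (x ^ p + y ^ p) ^ (p ℕ.^ k)                     ≈⟨ ^pᵏ-distrib-+ p-prime p×1≈0 k (x ^ p) (y ^ p) ⟩
    (x ^ p) ^ (p ℕ.^ k) + (y ^ p) ^ (p ℕ.^ k)       ≈⟨ +-cong (^-assocʳ x p _) (^-assocʳ y p _) ⟩
    x ^ (p ℕ.* p ℕ.^ k) + y ^ (p ℕ.* p ℕ.^ k)       ∎

module _ {c ℓ} (F : CommutativeRing c ℓ) where
  open CommutativeRing F
  open Exp semiring using (_^_)

  PowerIsAdditive : ℕ → Set (c ⊔ ℓ)
  PowerIsAdditive m = ∀ x y → (x + y) ^ m ≈ x ^ m + y ^ m

  PowerIsIdentity : ℕ → Set (c ⊔ ℓ)
  PowerIsIdentity m = ∀ x → x ^ m ≈ x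

module FieldOfPrimePowerOrder {c ℓ} (F : CommutativeRing c ℓ) (isField : IsField F)
  {p} (p-prime : Prime p) (k : ℕ) {q} (q≡pᵏ : q ≡ p ℕ.^ k) (d : ℕ)
  (enumeration : Bijection (≡.setoid (Fin (q ℕ.^ d))) (CommutativeRing.setoid F)) where
  open CommutativeRing F
  open FiniteField F isField enumeration public using (_≟_; x^N≈x)
  open FiniteField F isField enumeration using (N≡pᵐ⇒p×1≈0)
  open Frobenius F using (^pᵏ-distrib-+)
  open Exp semiring using (_^_)
  open import Algebra.Properties.Semiring.Mult semiring using (_×_)
  open import Algebra.Properties.Ring ring using (-1*x≈-x; -‿involutive)

  p×1≈0 : p × 1# ≈ 0#
  p×1≈0 = N≡pᵐ⇒p×1≈0 (k ℕ.* d) (≡.trans (≡.cong (ℕ._^ d) q≡pᵏ) (ℕ.^-*-assoc p k d))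

  σ-homo-+ : PowerIsAdditive F q
  σ-homo-+ = ≡.subst (λ r → ∀ x y → (x + y) ^ r ≈ x ^ r + y ^ r) (≡.sym q≡pᵏ) (^pᵏ-distrib-+ p-prime p×1≈0 k)

  char-2-or-square≈1 : ∀ {α} → (¬ 2 ∣ q → α ≈ - 1#) → 1# + 1# ≈ 0# ⊎ α * α ≈ 1#
  char-2-or-square≈1 {α} odd⇒α≈-1 with 2 ∣? q
  ... | no 2∤q = inj₂ (trans (*-cong (odd⇒α≈-1 2∤q) (odd⇒α≈-1 2∤q)) (trans (-1*x≈-x (- 1#)) (-‿involutive 1#)))
  ... | yes 2∣q with prime⇒irreducible p-prime (prime∣m^k⇒prime∣m prime[2] k (≡.subst (2 ∣_) q≡pᵏ 2∣q))
  ...   | inj₁ ()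
  ...   | inj₂ ≡.refl = inj₁ (trans (+-congˡ (sym (+-identityʳ 1#))) p×1≈0)

module Cap {c ℓ} (F : CommutativeRing c ℓ) (isField : IsField F) (_≟_ : Decidable (CommutativeRing._≈_ F))
  (q : ℕ) (σ-homo-+ : PowerIsAdditive F q) (n : ℕ) (σ-order : PowerIsIdentity F (q ℕ.^ (2 ℕ.* n ℕ.+ 1))) where
  open CommutativeRing F hiding (zero)
  open FieldProperties F isField
  open IntegerCoefficientSolver F using (solve; _:=_; _:+_; _:*_; _:-_; :-_)
  open import Algebra.Properties.Ring ring
    using (+-identityʳ-unique; +-inverseˡ-unique; +-inverseʳ-unique; x+x≈x⇒x≈0; x∙y⁻¹≈ε⇒x≈y; x≈y⇒x∙y⁻¹≈ε)
  open Exp semiring using (_^_; ^-congˡ; ^-homo-*; ^-assocʳ)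
  open import Algebra.Properties.CommutativeSemiring.Exp commutativeSemiring using (^-distrib-*)
  open import Algebra.Properties.Semiring.Mult semiring using (_×_; ×-congʳ; ×-homo-+; ×-assocˡ)
  open import Relation.Binary.Reasoning.Setoid setoid

  σ : Carrier → Carrier
  σ x = x ^ q

  Fixed : Carrier → Set ℓ
  Fixed x = σ x ≈ x

  pow≈^ : ∀ x m → pow F x m ≈ x ^ m
  pow≈^ x zero = refl
  pow≈^ x (suc m) = *-congˡ (pow≈^ x m)

  InFq⇒Fixed : ∀ {x} → InFq F q x → Fixed x
  InFq⇒Fixed {x} x∈Fq = trans (sym (pow≈^ x q)) x∈Fq

  Fixed⇒InFq : ∀ {x} → Fixed x → InFq F q x
  Fixed⇒InFq {x} x-fixed = trans (pow≈^ x q) x-fixed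

  σ-cong : ∀ {x y} → x ≈ y → σ x ≈ σ y
  σ-cong = ^-congˡ q

  σ-homo-* : ∀ x y → σ (x * y) ≈ σ x * σ y
  σ-homo-* x y = ^-distrib-* x y q

  σ-homo-0 : σ 0# ≈ 0#
  σ-homo-0 = x+x≈x⇒x≈0 (σ 0#) (trans (sym (σ-homo-+ 0# 0#)) (σ-cong (+-identityʳ 0#)))

  σ-homo-1 : σ 1# ≈ 1#
  σ-homo-1 = 1^m≈1 q
    where
    1^m≈1 : ∀ m → 1# ^ m ≈ 1#
    1^m≈1 zero = refl
    1^m≈1 (suc m) = trans (*-identityˡ _) (1^m≈1 m)

  σ-homo-neg : ∀ x → σ (- x) ≈ - σ x
  σ-homo-neg x = +-inverseˡ-unique (σ (- x)) (σ x)
    (trans (sym (σ-homo-+ (- x) x)) (trans (σ-cong (-‿inverseˡ x)) σ-homo-0))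

  σ-homo-× : ∀ m x → σ (m × x) ≈ m × σ x
  σ-homo-× zero x = σ-homo-0
  σ-homo-× (suc m) x = trans (σ-homo-+ x (m × x)) (+-congˡ (σ-homo-× m x))

  σ-nonzero : ∀ {x} → x ≉ 0# → σ x ≉ 0#
  σ-nonzero x≉0 = ^-nonzero x≉0 q

  σ-homo-⁻¹ : ∀ {x} (x≉0 : x ≉ 0#) → σ (x ⁻¹⟨ x≉0 ⟩) ≈ σ x ⁻¹⟨ σ-nonzero x≉0 ⟩
  σ-homo-⁻¹ {x} x≉0 = *-cancelˡ (σ-nonzero x≉0) (begin
    σ x * σ (x ⁻¹⟨ x≉0 ⟩)          ≈⟨ σ-homo-* x _ ⟨
    σ (x * x ⁻¹⟨ x≉0 ⟩)            ≈⟨ σ-cong (*-inverseʳ x x≉0) ⟩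
    σ 1#                           ≈⟨ σ-homo-1 ⟩
    1#                             ≈⟨ *-inverseʳ (σ x) (σ-nonzero x≉0) ⟨
    σ x * σ x ⁻¹⟨ σ-nonzero x≉0 ⟩  ∎)

  Fixed-cong : ∀ {x y} → x ≈ y → Fixed x → Fixed y
  Fixed-cong x≈y x-fixed = trans (σ-cong (sym x≈y)) (trans x-fixed x≈y)

  Fixed-1 : Fixed 1#
  Fixed-1 = σ-homo-1

  Fixed-+ : ∀ {x y} → Fixed x → Fixed y → Fixed (x + y)
  Fixed-+ x-fixed y-fixed = trans (σ-homo-+ _ _) (+-cong x-fixed y-fixed)

  Fixed-* : ∀ {x y} → Fixed x → Fixed y → Fixed (x * y)
  Fixed-* x-fixed y-fixed = trans (σ-homo-* _ _) (*-cong x-fixed y-fixed)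

  Fixed-neg : ∀ {x} → Fixed x → Fixed (- x)
  Fixed-neg x-fixed = trans (σ-homo-neg _) (-‿cong x-fixed)

  Fixed-⁻¹ : ∀ {x} (x≉0 : x ≉ 0#) → Fixed x → Fixed (x ⁻¹⟨ x≉0 ⟩)
  Fixed-⁻¹ {x} x≉0 x-fixed = *-cancelˡ x≉0 (begin
    x * σ (x ⁻¹⟨ x≉0 ⟩)             ≈⟨ *-cong (sym x-fixed) (σ-homo-⁻¹ x≉0) ⟩
    σ x * σ x ⁻¹⟨ σ-nonzero x≉0 ⟩   ≈⟨ *-inverseʳ (σ x) (σ-nonzero x≉0) ⟩
    1#                              ≈⟨ *-inverseʳ x x≉0 ⟨
    x * x ⁻¹⟨ x≉0 ⟩                 ∎)

  σ^j-translation : ∀ {w m} → σ w ≈ w + m → Fixed m → ∀ j → w ^ (q ℕ.^ j) ≈ w + j × m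
  σ^j-translation {w} {m} σw≈w+m m-fixed zero = trans (*-identityʳ w) (sym (+-identityʳ w))
  σ^j-translation {w} {m} σw≈w+m m-fixed (suc j) = begin
    w ^ (q ℕ.* q ℕ.^ j)        ≡⟨ ≡.cong (w ^_) (ℕ.*-comm q (q ℕ.^ j)) ⟩
    w ^ (q ℕ.^ j ℕ.* q)        ≈⟨ ^-assocʳ w (q ℕ.^ j) q ⟨
    σ (w ^ (q ℕ.^ j))          ≈⟨ σ-cong (σ^j-translation σw≈w+m m-fixed j) ⟩
    σ (w + j × m)              ≈⟨ σ-homo-+ w (j × m) ⟩
    σ w + σ (j × m)            ≈⟨ +-cong σw≈w+m (trans (σ-homo-× j m) (×-congʳ j m-fixed)) ⟩
    (w + m) + j × m            ≈⟨ +-assoc w m (j × m) ⟩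
    w + suc j × m              ∎

  1+1≈0⇒x+x≈0 : 1# + 1# ≈ 0# → ∀ x → x + x ≈ 0#
  1+1≈0⇒x+x≈0 1+1≈0 x = trans (sym (+-cong (*-identityˡ x) (*-identityˡ x)))
                             (trans (sym (distribʳ x 1# 1#)) (trans (*-congʳ 1+1≈0) (zeroˡ x)))

  1+1≈0⇒[2n+1]×x≈x : 1# + 1# ≈ 0# → ∀ x → (2 ℕ.* n ℕ.+ 1) × x ≈ x
  1+1≈0⇒[2n+1]×x≈x 1+1≈0 x = begin
    (2 ℕ.* n ℕ.+ 1) × x        ≈⟨ ×-homo-+ x (2 ℕ.* n) 1 ⟩
    (2 ℕ.* n) × x + 1 × x      ≈⟨ +-cong (sym (×-assocˡ x 2 n)) (+-identityʳ x) ⟩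
    2 × (n × x) + x            ≈⟨ +-congʳ (trans (+-congˡ (+-identityʳ _)) (1+1≈0⇒x+x≈0 1+1≈0 (n × x))) ⟩
    0# + x                     ≈⟨ +-identityˡ x ⟩
    x                          ∎

  artin-schreier : 1# + 1# ≈ 0# → ∀ {w m} → σ w ≈ w + m → Fixed m → m ≈ 0#
  artin-schreier 1+1≈0 {w} {m} σw≈w+m m-fixed = trans (sym (1+1≈0⇒[2n+1]×x≈x 1+1≈0 m))
    (+-identityʳ-unique w _ (trans (sym (σ^j-translation σw≈w+m m-fixed (2 ℕ.* n ℕ.+ 1))) (σ-order w)))

  pow-2 : ∀ x → pow F x 2 ≈ x * x
  pow-2 x = *-congˡ (*-identityʳ x)

  pow-q+1 : ∀ x → pow F x (q ℕ.+ 1) ≈ σ x * x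
  pow-q+1 x = trans (pow≈^ x (q ℕ.+ 1)) (trans (^-homo-* x q 1) (*-congˡ (*-identityʳ x)))

  pow-2-scale : ∀ {x y t} → x ≈ t * y → pow F x 2 ≈ (t * t) * pow F y 2
  pow-2-scale {x} {y} {t} x≈ty = begin
    pow F x 2              ≈⟨ pow-2 x ⟩
    x * x                  ≈⟨ *-cong x≈ty x≈ty ⟩
    (t * y) * (t * y)      ≈⟨ solve 2 (λ t y → (t :* y) :* (t :* y) := (t :* t) :* (y :* y)) refl t y ⟩
    (t * t) * (y * y)      ≈⟨ *-congˡ (pow-2 y) ⟨
    (t * t) * pow F y 2    ∎

  pow-q+1-scale : ∀ {x y t} → x ≈ t * y → pow F x (q ℕ.+ 1) ≈ (σ t * t) * pow F y (q ℕ.+ 1)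
  pow-q+1-scale {x} {y} {t} x≈ty = begin
    pow F x (q ℕ.+ 1)              ≈⟨ pow-q+1 x ⟩
    σ x * x                        ≈⟨ *-cong (trans (σ-cong x≈ty) (σ-homo-* t y)) x≈ty ⟩
    (σ t * σ y) * (t * y)          ≈⟨ solve 4 (λ σt σy t y → (σt :* σy) :* (t :* y) := (σt :* t) :* (σy :* y)) refl (σ t) (σ y) t y ⟩
    (σ t * t) * (σ y * y)          ≈⟨ *-congˡ (pow-q+1 y) ⟨
    (σ t * t) * pow F y (q ℕ.+ 1)  ∎

  samePoint-scaled : ∀ {ω ω′ x y t} → ω ≈ ω′ → Fixed t → t ≉ 0# → x ≈ t * y →
                     SamePoint F q (vpt F q ω x) (vpt F q ω′ y)
  samePoint-scaled {ω} {ω′} {x} {y} {t} ω≈ω′ t-fixed t≉0 x≈ty =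
    t * t , Fixed⇒InFq (Fixed-* t-fixed t-fixed) , *-nonzero t≉0 t≉0 , pow-2-scale x≈ty , (begin
      ω * pow F x (q ℕ.+ 1)       ≈⟨ *-cong ω≈ω′ (pow-q+1-scale x≈ty) ⟩
      ω′ * ((σ t * t) * Y)        ≈⟨ *-congˡ (*-congʳ (*-congʳ t-fixed)) ⟩
      ω′ * ((t * t) * Y)          ≈⟨ solve 3 (λ ω′ T Y → ω′ :* (T :* Y) := T :* (ω′ :* Y)) refl ω′ (t * t) Y ⟩
      (t * t) * (ω′ * Y)          ∎)
    where Y = pow F y (q ℕ.+ 1)

  LinearRelation₂ : Carrier → Carrier → Vec2 F → Vec2 F → Set ℓ
  LinearRelation₂ λ₁ λ₂ u v = _≈₂_ F (_+₂_ F (_·₂_ F λ₁ u) (_·₂_ F λ₂ v)) (0₂ F)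

  LinearRelation₃ : Carrier → Carrier → Carrier → Vec2 F → Vec2 F → Vec2 F → Set ℓ
  LinearRelation₃ λ₁ λ₂ λ₃ u v w = _≈₂_ F (_+₂_ F (_+₂_ F (_·₂_ F λ₁ u) (_·₂_ F λ₂ v)) (_·₂_ F λ₃ w)) (0₂ F)

  samePoint-of-relation₂ : ∀ {λ₁ λ₂} u v → Fixed λ₁ → Fixed λ₂ → λ₁ ≉ 0# → λ₂ ≉ 0# →
                           LinearRelation₂ λ₁ λ₂ u v → SamePoint F q u v
  samePoint-of-relation₂ {λ₁} {λ₂} _ _ λ₁-fixed λ₂-fixed λ₁≉0 λ₂≉0 (rel₁ , rel₂) =
    ν , Fixed⇒InFq (Fixed-neg (Fixed-* (Fixed-⁻¹ λ₁≉0 λ₁-fixed) λ₂-fixed)) ,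
    -‿nonzero (*-nonzero (⁻¹-nonzero λ₁≉0) λ₂≉0) , solve-for rel₁ , solve-for rel₂
    where
    ν = - (λ₁ ⁻¹⟨ λ₁≉0 ⟩ * λ₂)
    solve-for : ∀ {a b} → λ₁ * a + λ₂ * b ≈ 0# → a ≈ ν * b
    solve-for {a} {b} rel = *-cancelˡ λ₁≉0 (begin
      λ₁ * a                                  ≈⟨ +-inverseˡ-unique _ _ rel ⟩
      - (λ₂ * b)                              ≈⟨ -‿cong (*-identityˡ _) ⟨
      - (1# * (λ₂ * b))                       ≈⟨ -‿cong (*-congʳ (*-inverseʳ λ₁ λ₁≉0)) ⟨
      - ((λ₁ * λ₁ ⁻¹⟨ λ₁≉0 ⟩) * (λ₂ * b))     ≈⟨ solve 4 (λ l i m b → :- ((l :* i) :* (m :* b)) := l :* ((:- (i :* m)) :* b)) refl λ₁ _ λ₂ b ⟩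
      λ₁ * (ν * b)                            ∎)

  zero-term : ∀ {λ₁} x → λ₁ ≈ 0# → λ₁ * x ≈ 0#
  zero-term x λ₁≈0 = trans (*-congʳ λ₁≈0) (zeroˡ x)

  drop-zeroˡ : ∀ {x y} → x ≈ 0# → x + y ≈ 0# → y ≈ 0#
  drop-zeroˡ x≈0 x+y≈0 = trans (sym (trans (+-congʳ x≈0) (+-identityˡ _))) x+y≈0

  drop-zeroʳ : ∀ {x y} → y ≈ 0# → x + y ≈ 0# → x ≈ 0#
  drop-zeroʳ y≈0 x+y≈0 = trans (sym (trans (+-congˡ y≈0) (+-identityʳ _))) x+y≈0

  independent₂ : ∀ {λ₁ λ₂} u v → ¬ SamePoint F q u v → proj₁ u ≉ 0# → proj₁ v ≉ 0# →
                 Fixed λ₁ → Fixed λ₂ → LinearRelation₂ λ₁ λ₂ u v → λ₁ ≈ 0# Product.× λ₂ ≈ 0#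
  independent₂ {λ₁} {λ₂} u@(u₁ , _) v@(v₁ , _) ¬same u₁≉0 v₁≉0 λ₁-fixed λ₂-fixed rel with λ₁ ≟ 0# | λ₂ ≟ 0#
  ... | yes λ₁≈0 | _       = λ₁≈0 , xy≈0⇒x≈0 v₁≉0 (drop-zeroˡ (zero-term u₁ λ₁≈0) (proj₁ rel))
  ... | no λ₁≉0 | yes λ₂≈0 = contradiction (xy≈0⇒x≈0 u₁≉0 (drop-zeroʳ (zero-term v₁ λ₂≈0) (proj₁ rel))) λ₁≉0
  ... | no λ₁≉0 | no λ₂≉0  = contradiction (samePoint-of-relation₂ u v λ₁-fixed λ₂-fixed λ₁≉0 λ₂≉0 rel) ¬same

  LinearRelation₃-rotate : ∀ {λ₁ λ₂ λ₃} u v w → LinearRelation₃ λ₁ λ₂ λ₃ u v w → LinearRelation₃ λ₂ λ₃ λ₁ v w u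
  LinearRelation₃-rotate _ _ _ = Product.map rotate rotate
    where
    rotate : ∀ {x y z} → (x + y) + z ≈ 0# → (y + z) + x ≈ 0#
    rotate = trans (trans (+-comm _ _) (sym (+-assoc _ _ _)))

  LinearRelation₃-swap : ∀ {λ₁ λ₂ λ₃} u v w → LinearRelation₃ λ₁ λ₂ λ₃ u v w → LinearRelation₃ λ₁ λ₃ λ₂ u w v
  LinearRelation₃-swap _ _ _ = Product.map swap swap
    where
    swap : ∀ {x y z} → (x + y) + z ≈ 0# → (x + z) + y ≈ 0#
    swap = trans (trans (+-assoc _ _ _) (trans (+-congˡ (+-comm _ _)) (sym (+-assoc _ _ _))))

  LinearRelation₃-drop : ∀ {λ₁ λ₂ λ₃} u v w → λ₃ ≈ 0# → LinearRelation₃ λ₁ λ₂ λ₃ u v w → LinearRelation₂ λ₁ λ₂ u v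
  LinearRelation₃-drop _ _ (w₁ , w₂) λ₃≈0 = Product.map (drop-zeroʳ (zero-term w₁ λ₃≈0)) (drop-zeroʳ (zero-term w₂ λ₃≈0))

  square≈0⇒≈0 : ∀ {x} → x * x ≈ 0# → x ≈ 0#
  square≈0⇒≈0 {x} x²≈0 with x ≟ 0#
  ... | yes x≈0 = x≈0
  ... | no x≉0  = contradiction x²≈0 (*-nonzero x≉0 x≉0)

  lagrange-identity : ∀ a b x y → (a * (x * x) + b) * (a * (y * y) + b) ≈
                      (a * (y * x) + b) * (a * (y * x) + b) + (a * b) * ((x - y) * (x - y))
  lagrange-identity = solve 4 (λ a b x y → (a :* (x :* x) :+ b) :* (a :* (y :* y) :+ b) :=
                      (a :* (y :* x) :+ b) :* (a :* (y :* x) :+ b) :+ (a :* b) :* ((x :- y) :* (x :- y))) refl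

  lagrange-equality : ∀ {a b ω x y} → a ≉ 0# → b ≉ 0# → ω ≉ 0# →
                      (ω * (a * (y * x) + b)) * (ω * (a * (y * x) + b)) ≈ (ω * ω) * ((a * (x * x) + b) * (a * (y * y) + b)) →
                      x ≈ y
  lagrange-equality {a} {b} {ω} {x} {y} a≉0 b≉0 ω≉0 eq =
    x∙y⁻¹≈ε⇒x≈y x y (square≈0⇒≈0 (xy≈0⇒y≈0 (*-nonzero a≉0 b≉0) (+-identityʳ-unique (P * P) _ (begin
      P * P + (a * b) * ((x - y) * (x - y))    ≈⟨ lagrange-identity a b x y ⟨
      U * V                                    ≈⟨ *-cancelˡ (*-nonzero ω≉0 ω≉0) (trans (sym eq) (ωP²≈ω²P² ω P)) ⟩
      P * P                                    ∎))))
    where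
    P = a * (y * x) + b
    U = a * (x * x) + b
    V = a * (y * y) + b
    ωP²≈ω²P² : ∀ ω P → (ω * P) * (ω * P) ≈ (ω * ω) * (P * P)
    ωP²≈ω²P² = solve 2 (λ ω P → (ω :* P) :* (ω :* P) := (ω :* ω) :* (P :* P)) refl

  -- In characteristic 2, a (x - y)² = U - V, so the Lagrange identity becomes linear in U and V.
  char-2-lagrange : 1# + 1# ≈ 0# → ∀ {a b ω ω′ x y} →
                    (ω * (a * (y * x) + b)) * (ω * (a * (y * x) + b)) ≈ (ω′ * ω′) * ((a * (x * x) + b) * (a * (y * y) + b)) →
                    (ω′ * ω′ - ω * ω) * ((a * (x * x) + b) * (a * (y * y) + b)) +
                    ((ω * ω) * b) * ((a * (x * x) + b) - (a * (y * y) + b)) ≈ 0#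
  char-2-lagrange 1+1≈0 {a} {b} {ω} {ω′} {x} {y} eq = begin
    Δ * (U * V) + K * (U - V)                     ≈⟨ +-congˡ (*-congˡ aD≈U-V) ⟨
    Δ * (U * V) + K * (a * ((x - y) * (x - y)))   ≈⟨ solve 6 (λ ω ω′ a b x y →
         (ω′ :* ω′ :- ω :* ω) :* ((a :* (x :* x) :+ b) :* (a :* (y :* y) :+ b)) :+ ((ω :* ω) :* b) :* (a :* ((x :- y) :* (x :- y))) :=
         (ω′ :* ω′) :* ((a :* (x :* x) :+ b) :* (a :* (y :* y) :+ b)) :- (ω :* (a :* (y :* x) :+ b)) :* (ω :* (a :* (y :* x) :+ b)))
         refl ω ω′ a b x y ⟩
    (ω′ * ω′) * (U * V) - (ω * P) * (ω * P)       ≈⟨ x≈y⇒x∙y⁻¹≈ε (sym eq) ⟩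
    0#                                            ∎
    where
    P = a * (y * x) + b
    U = a * (x * x) + b
    V = a * (y * y) + b
    Δ = ω′ * ω′ - ω * ω
    K = (ω * ω) * b
    aD≈U-V : a * ((x - y) * (x - y)) ≈ U - V
    aD≈U-V = begin
      a * ((x - y) * (x - y))  ≈⟨ solve 4 (λ a b x y → a :* ((x :- y) :* (x :- y)) :=
                                    ((a :* (x :* x) :+ b) :- (a :* (y :* y) :+ b)) :+ (a :* (y :* (y :- x)) :+ a :* (y :* (y :- x))))
                                    refl a b x y ⟩
      (U - V) + (z + z)        ≈⟨ +-congˡ (1+1≈0⇒x+x≈0 1+1≈0 z) ⟩
      (U - V) + 0#             ≈⟨ +-identityʳ _ ⟩
      U - V                    ∎
      where z = a * (y * (y - x))

  c[UV]+K[U-V]≈0⇒c+K[V⁻¹-U⁻¹]≈0 : ∀ {c K U V} (U≉0 : U ≉ 0#) (V≉0 : V ≉ 0#) → c * (U * V) + K * (U - V) ≈ 0# →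
                                  c + K * (V ⁻¹⟨ V≉0 ⟩ - U ⁻¹⟨ U≉0 ⟩) ≈ 0#
  c[UV]+K[U-V]≈0⇒c+K[V⁻¹-U⁻¹]≈0 {c} {K} {U} {V} U≉0 V≉0 eq = begin
    c + K * (v - u)                                     ≈⟨ +-cong (*-identityʳ c) (*-congˡ (+-cong (*-identityˡ v) (-‿cong (*-identityˡ u)))) ⟨
    c * 1# + K * (1# * v - 1# * u)                      ≈⟨ +-cong (*-congˡ (trans (*-cong Uu≈1 Vv≈1) (*-identityˡ 1#)))
                                                                 (*-congˡ (+-cong (*-congʳ Uu≈1) (-‿cong (*-congʳ Vv≈1)))) ⟨
    c * ((U * u) * (V * v)) + K * ((U * u) * v - (V * v) * u) ≈⟨ solve 6 (λ c K U V u v →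
         c :* ((U :* u) :* (V :* v)) :+ K :* ((U :* u) :* v :- (V :* v) :* u) := (c :* (U :* V) :+ K :* (U :- V)) :* (u :* v))
         refl c K U V u v ⟩
    (c * (U * V) + K * (U - V)) * (u * v)               ≈⟨ trans (*-congʳ eq) (zeroˡ _) ⟩
    0#                                                  ∎
    where
    u = U ⁻¹⟨ U≉0 ⟩
    v = V ⁻¹⟨ V≉0 ⟩
    Uu≈1 = *-inverseʳ U U≉0
    Vv≈1 = *-inverseʳ V V≉0

  -- In characteristic 2, σ(1/U) = 1/U + m with m = -Δ/K fixed, and Artin–Schreier forces m = 0.
  char-2-weights : 1# + 1# ≈ 0# → ∀ {a b ω ω′ t} → Fixed a → Fixed b → Fixed ω → Fixed ω′ → b ≉ 0# → ω ≉ 0# →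
                   a * (t * t) + b ≉ 0# →
                   (ω * (a * (σ t * t) + b)) * (ω * (a * (σ t * t) + b)) ≈ (ω′ * ω′) * ((a * (t * t) + b) * (a * (σ t * σ t) + b)) →
                   ω′ * ω′ ≈ ω * ω
  char-2-weights 1+1≈0 {a} {b} {ω} {ω′} {t} a-fixed b-fixed ω-fixed ω′-fixed b≉0 ω≉0 U≉0 eq = x∙y⁻¹≈ε⇒x≈y _ _ Δ≈0
    where
    U = a * (t * t) + b
    V = a * (σ t * σ t) + b
    Δ = ω′ * ω′ - ω * ω
    K = (ω * ω) * b
    σU≈V : σ U ≈ V
    σU≈V = trans (σ-homo-+ _ _) (+-cong (trans (σ-homo-* a _) (*-cong a-fixed (σ-homo-* t t))) b-fixed)
    V≉0 : V ≉ 0#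
    V≉0 = σ-nonzero U≉0 ∘ trans σU≈V
    K≉0 : K ≉ 0#
    K≉0 = *-nonzero (*-nonzero ω≉0 ω≉0) b≉0
    w = U ⁻¹⟨ U≉0 ⟩
    m = K ⁻¹⟨ K≉0 ⟩ * - Δ
    m-fixed : Fixed m
    m-fixed = Fixed-* (Fixed-⁻¹ K≉0 (Fixed-* (Fixed-* ω-fixed ω-fixed) b-fixed))
                      (Fixed-neg (Fixed-+ (Fixed-* ω′-fixed ω′-fixed) (Fixed-neg (Fixed-* ω-fixed ω-fixed))))
    K[σw-w]≈-Δ : K * (σ w - w) ≈ - Δ
    K[σw-w]≈-Δ = +-inverseʳ-unique Δ _
      (trans (+-congˡ (*-congˡ (+-congʳ (trans (σ-homo-⁻¹ U≉0) (⁻¹-cong _ V≉0 σU≈V)))))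
             (c[UV]+K[U-V]≈0⇒c+K[V⁻¹-U⁻¹]≈0 U≉0 V≉0 (char-2-lagrange 1+1≈0 eq)))
    σw-w≈m : σ w - w ≈ m
    σw-w≈m = *-cancelˡ K≉0 (trans K[σw-w]≈-Δ (sym (trans (sym (*-assoc _ _ _)) (trans (*-congʳ (*-inverseʳ K K≉0)) (*-identityˡ _)))))
    σw≈w+m : σ w ≈ w + m
    σw≈w+m = trans (solve 2 (λ w σw → σw := w :+ (σw :- w)) refl w (σ w)) (+-congˡ σw-w≈m)
    Δ≈0 : Δ ≈ 0#
    Δ≈0 = -x≈0⇒x≈0 (trans (sym K[σw-w]≈-Δ) (trans (*-congˡ (trans σw-w≈m (artin-schreier 1+1≈0 σw≈w+m m-fixed))) (zeroʳ K)))

  dehomogenise₁ : ∀ {λa λb λc xa xb xc t s} → xb ≉ 0# → xa ≈ t * xb → xc ≈ s * xb →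
                  (λa * pow F xa 2 + λb * pow F xb 2) + λc * pow F xc 2 ≈ 0# →
                  (λa * (t * t) + λb) + λc * (s * s) ≈ 0#
  dehomogenise₁ {λa} {λb} {λc} {xa} {xb} {xc} {t} {s} xb≉0 xa≈txb xc≈sxb rel =
    xy≈0⇒x≈0 (*-nonzero xb≉0 xb≉0 ∘ trans (sym (pow-2 xb))) (begin
      ((λa * (t * t) + λb) + λc * (s * s)) * X               ≈⟨ solve 6 (λ a b c T S X →
           ((a :* T :+ b) :+ c :* S) :* X := (a :* (T :* X) :+ b :* X) :+ c :* (S :* X)) refl λa λb λc (t * t) (s * s) X ⟩
      (λa * ((t * t) * X) + λb * X) + λc * ((s * s) * X)     ≈⟨ +-cong (+-congʳ (*-congˡ (pow-2-scale xa≈txb))) (*-congˡ (pow-2-scale xc≈sxb)) ⟨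
      (λa * pow F xa 2 + λb * X) + λc * pow F xc 2           ≈⟨ rel ⟩
      0#                                                     ∎)
    where X = pow F xb 2

  dehomogenise₂ : ∀ {λa λb λc xa xb xc ωa ωb ωc t s} → xb ≉ 0# → ωa ≈ ωb → xa ≈ t * xb → xc ≈ s * xb →
                  (λa * (ωa * pow F xa (q ℕ.+ 1)) + λb * (ωb * pow F xb (q ℕ.+ 1))) + λc * (ωc * pow F xc (q ℕ.+ 1)) ≈ 0# →
                  ωa * (λa * (σ t * t) + λb) + ωc * (λc * (σ s * s)) ≈ 0#
  dehomogenise₂ {λa} {λb} {λc} {xa} {xb} {xc} {ωa} {ωb} {ωc} {t} {s} xb≉0 ωa≈ωb xa≈txb xc≈sxb rel =
    xy≈0⇒x≈0 (*-nonzero (σ-nonzero xb≉0) xb≉0 ∘ trans (sym (pow-q+1 xb))) (begin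
      (ωa * (λa * (σ t * t) + λb) + ωc * (λc * (σ s * s))) * Y
        ≈⟨ solve 8 (λ w a T b w′ c S Y → (w :* (a :* T :+ b) :+ w′ :* (c :* S)) :* Y :=
             (a :* (w :* (T :* Y)) :+ b :* (w :* Y)) :+ c :* (w′ :* (S :* Y))) refl ωa λa (σ t * t) λb ωc λc (σ s * s) Y ⟩
      (λa * (ωa * ((σ t * t) * Y)) + λb * (ωa * Y)) + λc * (ωc * ((σ s * s) * Y))
        ≈⟨ +-cong (+-cong (*-congˡ (*-congˡ (pow-q+1-scale xa≈txb))) (*-congˡ (*-congʳ (sym ωa≈ωb))))
                  (*-congˡ (*-congˡ (pow-q+1-scale xc≈sxb))) ⟨
      (λa * (ωa * pow F xa (q ℕ.+ 1)) + λb * (ωb * Y)) + λc * (ωc * pow F xc (q ℕ.+ 1))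
        ≈⟨ rel ⟩
      0# ∎)
    where Y = pow F xb (q ℕ.+ 1)

  squared-relation : ∀ {λa λb λc ωa ωc t s} → Fixed λa → Fixed λb → Fixed λc →
                     (λa * (t * t) + λb) + λc * (s * s) ≈ 0# →
                     ωa * (λa * (σ t * t) + λb) + ωc * (λc * (σ s * s)) ≈ 0# →
                     (ωa * (λa * (σ t * t) + λb)) * (ωa * (λa * (σ t * t) + λb)) ≈
                     (ωc * ωc) * ((λa * (t * t) + λb) * (λa * (σ t * σ t) + λb))
  squared-relation {λa} {λb} {λc} {ωa} {ωc} {t} {s} λa-fixed λb-fixed λc-fixed rel₁ rel₂ = begin
    (ωa * P) * (ωa * P)                                         ≈⟨ *-cong ωaP≈ ωaP≈ ⟩
    (- (ωc * (λc * (σ s * s)))) * (- (ωc * (λc * (σ s * s))))   ≈⟨ solve 4 (λ w c s σs →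
         (:- (w :* (c :* (σs :* s)))) :* (:- (w :* (c :* (σs :* s)))) := (w :* w) :* ((:- (c :* (s :* s))) :* (:- (c :* (σs :* σs)))))
         refl ωc λc s (σ s) ⟩
    (ωc * ωc) * ((- (λc * (s * s))) * (- (λc * (σ s * σ s))))   ≈⟨ *-congˡ (*-cong U≈ V≈) ⟨
    (ωc * ωc) * (U * V)                                         ∎
    where
    P = λa * (σ t * t) + λb
    U = λa * (t * t) + λb
    V = λa * (σ t * σ t) + λb
    U≈ : U ≈ - (λc * (s * s))
    U≈ = +-inverseˡ-unique _ _ rel₁
    V≈ : V ≈ - (λc * (σ s * σ s))
    V≈ = +-inverseˡ-unique _ _ (begin
      (λa * (σ t * σ t) + λb) + λc * (σ s * σ s)   ≈⟨ +-cong (+-cong (*-cong λa-fixed (σ-homo-* t t)) λb-fixed) (*-cong λc-fixed (σ-homo-* s s)) ⟨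
      (σ λa * σ (t * t) + σ λb) + σ λc * σ (s * s) ≈⟨ +-cong (+-congʳ (σ-homo-* λa _)) (σ-homo-* λc _) ⟨
      (σ (λa * (t * t)) + σ λb) + σ (λc * (s * s)) ≈⟨ +-congʳ (σ-homo-+ _ _) ⟨
      σ (λa * (t * t) + λb) + σ (λc * (s * s))     ≈⟨ σ-homo-+ _ _ ⟨
      σ ((λa * (t * t) + λb) + λc * (s * s))       ≈⟨ σ-cong rel₁ ⟩
      σ 0#                                         ≈⟨ σ-homo-0 ⟩
      0#                                           ∎)
    ωaP≈ : ωa * P ≈ - (ωc * (λc * (σ s * s)))
    ωaP≈ = +-inverseˡ-unique _ _ rel₂

  samePoint-of-equal-weights : ∀ {λa λb λc xa xb xc ωa ωb ωc} →
    Fixed λa → Fixed λb → Fixed λc → λa ≉ 0# → λb ≉ 0# → λc ≉ 0# → xa ≉ 0# → xb ≉ 0# → xc ≉ 0# →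
    Fixed ωa → Fixed ωc → ωa ≉ 0# → ωa ≈ ωb → 1# + 1# ≈ 0# ⊎ ωc * ωc ≈ ωa * ωa →
    LinearRelation₃ λa λb λc (vpt F q ωa xa) (vpt F q ωb xb) (vpt F q ωc xc) →
    SamePoint F q (vpt F q ωa xa) (vpt F q ωb xb)
  samePoint-of-equal-weights {λa} {λb} {λc} {xa} {xb} {xc} {ωa} {ωb} {ωc} λa-fixed λb-fixed λc-fixed λa≉0 λb≉0 λc≉0
    xa≉0 xb≉0 xc≉0 ωa-fixed ωc-fixed ωa≉0 ωa≈ωb char-2-or-equal-squares (rel₁ , rel₂) =
    samePoint-scaled ωa≈ωb (sym t≈σt) (ratio-nonzero xa≉0) (ratio xa)
    where
    ratio : ∀ x → x ≈ (x * xb ⁻¹⟨ xb≉0 ⟩) * xb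
    ratio x = sym (trans (*-assoc x _ xb) (trans (*-congˡ (*-inverseˡ xb xb≉0)) (*-identityʳ x)))
    ratio-nonzero : ∀ {x} → x ≉ 0# → x * xb ⁻¹⟨ xb≉0 ⟩ ≉ 0#
    ratio-nonzero x≉0 = *-nonzero x≉0 (⁻¹-nonzero xb≉0)
    t = xa * xb ⁻¹⟨ xb≉0 ⟩
    s = xc * xb ⁻¹⟨ xb≉0 ⟩
    dehomogenised₁ = dehomogenise₁ {λa} {λb} {λc} xb≉0 (ratio xa) (ratio xc) rel₁
    squared = squared-relation λa-fixed λb-fixed λc-fixed dehomogenised₁
                (dehomogenise₂ {λa} {λb} {λc} xb≉0 ωa≈ωb (ratio xa) (ratio xc) rel₂)
    U≉0 : λa * (t * t) + λb ≉ 0#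
    U≉0 = -‿nonzero (*-nonzero λc≉0 (*-nonzero (ratio-nonzero xc≉0) (ratio-nonzero xc≉0)))
        ∘ trans (sym (+-inverseˡ-unique _ _ dehomogenised₁))
    equal-squares : ωc * ωc ≈ ωa * ωa
    equal-squares = Sum.[ (λ 1+1≈0 → char-2-weights 1+1≈0 λa-fixed λb-fixed ωa-fixed ωc-fixed λb≉0 ωa≉0 U≉0 squared)
                        , id ] char-2-or-equal-squares
    t≈σt : t ≈ σ t
    t≈σt = lagrange-equality λa≉0 λb≉0 ωa≉0 (trans squared (*-congʳ equal-squares))

  module _ {α} (α-fixed : Fixed α) (α≉0 : α ≉ 0#) (char-2-or-α²≈1 : 1# + 1# ≈ 0# ⊎ α * α ≈ 1#) where

    IsWeight : Carrier → Set ℓ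
    IsWeight ω = ω ≈ 1# ⊎ ω ≈ α

    weight-fixed : ∀ {ω} → IsWeight ω → Fixed ω
    weight-fixed (inj₁ ω≈1) = Fixed-cong (sym ω≈1) Fixed-1
    weight-fixed (inj₂ ω≈α) = Fixed-cong (sym ω≈α) α-fixed

    weight-nonzero : ∀ {ω} → IsWeight ω → ω ≉ 0#
    weight-nonzero (inj₁ ω≈1) = 1≉0 ∘ trans (sym ω≈1)
    weight-nonzero (inj₂ ω≈α) = α≉0 ∘ trans (sym ω≈α)

    char-2-or-equal-squares : ∀ {ω ω′} → IsWeight ω → IsWeight ω′ → 1# + 1# ≈ 0# ⊎ ω′ * ω′ ≈ ω * ω
    char-2-or-equal-squares ω-weight ω′-weight =
      Sum.map₂ (λ α²≈1 → trans (square≈1 α²≈1 ω′-weight) (sym (square≈1 α²≈1 ω-weight))) char-2-or-α²≈1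
      where
      square≈1 : α * α ≈ 1# → ∀ {ω} → IsWeight ω → ω * ω ≈ 1#
      square≈1 _ (inj₁ ω≈1) = trans (*-cong ω≈1 ω≈1) (*-identityˡ 1#)
      square≈1 α²≈1 (inj₂ ω≈α) = trans (*-cong ω≈α ω≈α) α²≈1

    weights-pigeonhole : ∀ {ω₁ ω₂ ω₃} → IsWeight ω₁ → IsWeight ω₂ → IsWeight ω₃ → ω₁ ≈ ω₂ ⊎ ω₁ ≈ ω₃ ⊎ ω₂ ≈ ω₃
    weights-pigeonhole (inj₁ ω₁≈1) (inj₁ ω₂≈1) _           = inj₁ (trans ω₁≈1 (sym ω₂≈1))
    weights-pigeonhole (inj₂ ω₁≈α) (inj₂ ω₂≈α) _           = inj₁ (trans ω₁≈α (sym ω₂≈α))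
    weights-pigeonhole (inj₁ ω₁≈1) (inj₂ _)    (inj₁ ω₃≈1) = inj₂ (inj₁ (trans ω₁≈1 (sym ω₃≈1)))
    weights-pigeonhole (inj₂ ω₁≈α) (inj₁ _)    (inj₂ ω₃≈α) = inj₂ (inj₁ (trans ω₁≈α (sym ω₃≈α)))
    weights-pigeonhole (inj₁ _)    (inj₂ ω₂≈α) (inj₂ ω₃≈α) = inj₂ (inj₂ (trans ω₂≈α (sym ω₃≈α)))
    weights-pigeonhole (inj₂ _)    (inj₁ ω₂≈1) (inj₁ ω₃≈1) = inj₂ (inj₂ (trans ω₂≈1 (sym ω₃≈1)))

    two-points-coincide : ∀ {λ₁ λ₂ λ₃ x₁ x₂ x₃ ω₁ ω₂ ω₃} → Fixed λ₁ → Fixed λ₂ → Fixed λ₃ →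
      λ₁ ≉ 0# → λ₂ ≉ 0# → λ₃ ≉ 0# → x₁ ≉ 0# → x₂ ≉ 0# → x₃ ≉ 0# → IsWeight ω₁ → IsWeight ω₂ → IsWeight ω₃ →
      LinearRelation₃ λ₁ λ₂ λ₃ (vpt F q ω₁ x₁) (vpt F q ω₂ x₂) (vpt F q ω₃ x₃) →
      SamePoint F q (vpt F q ω₁ x₁) (vpt F q ω₂ x₂) ⊎ SamePoint F q (vpt F q ω₁ x₁) (vpt F q ω₃ x₃) ⊎
      SamePoint F q (vpt F q ω₂ x₂) (vpt F q ω₃ x₃)
    two-points-coincide {x₁ = x₁} {x₂} {x₃} {ω₁} {ω₂} {ω₃} λ₁-fixed λ₂-fixed λ₃-fixed λ₁≉0 λ₂≉0 λ₃≉0 x₁≉0 x₂≉0 x₃≉0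
      ω₁-weight ω₂-weight ω₃-weight rel with weights-pigeonhole ω₁-weight ω₂-weight ω₃-weight
    ... | inj₁ ω₁≈ω₂ = inj₁ (samePoint-of-equal-weights λ₁-fixed λ₂-fixed λ₃-fixed λ₁≉0 λ₂≉0 λ₃≉0 x₁≉0 x₂≉0 x₃≉0
            (weight-fixed ω₁-weight) (weight-fixed ω₃-weight) (weight-nonzero ω₁-weight) ω₁≈ω₂
            (char-2-or-equal-squares ω₁-weight ω₃-weight) rel)
    ... | inj₂ (inj₁ ω₁≈ω₃) = inj₂ (inj₁ (samePoint-of-equal-weights λ₁-fixed λ₃-fixed λ₂-fixed λ₁≉0 λ₃≉0 λ₂≉0 x₁≉0 x₃≉0 x₂≉0
            (weight-fixed ω₁-weight) (weight-fixed ω₂-weight) (weight-nonzero ω₁-weight) ω₁≈ω₃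
            (char-2-or-equal-squares ω₁-weight ω₂-weight) (LinearRelation₃-swap (vpt F q ω₁ x₁) _ _ rel)))
    ... | inj₂ (inj₂ ω₂≈ω₃) = inj₂ (inj₂ (samePoint-of-equal-weights λ₂-fixed λ₃-fixed λ₁-fixed λ₂≉0 λ₃≉0 λ₁≉0 x₂≉0 x₃≉0 x₁≉0
            (weight-fixed ω₂-weight) (weight-fixed ω₁-weight) (weight-nonzero ω₂-weight) ω₂≈ω₃
            (char-2-or-equal-squares ω₂-weight ω₁-weight) (LinearRelation₃-rotate (vpt F q ω₁ x₁) _ _ rel)))

    cap : ∀ {x₁ x₂ x₃ ω₁ ω₂ ω₃} → x₁ ≉ 0# → x₂ ≉ 0# → x₃ ≉ 0# → IsWeight ω₁ → IsWeight ω₂ → IsWeight ω₃ →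
          ¬ SamePoint F q (vpt F q ω₁ x₁) (vpt F q ω₂ x₂) →
          ¬ SamePoint F q (vpt F q ω₁ x₁) (vpt F q ω₃ x₃) →
          ¬ SamePoint F q (vpt F q ω₂ x₂) (vpt F q ω₃ x₃) →
          ¬ FqDependent3 F q (vpt F q ω₁ x₁) (vpt F q ω₂ x₂) (vpt F q ω₃ x₃)
    cap {x₁} {x₂} {x₃} {ω₁} {ω₂} {ω₃} x₁≉0 x₂≉0 x₃≉0 ω₁-weight ω₂-weight ω₃-weight ¬P₁P₂ ¬P₁P₃ ¬P₂P₃
        (λ₁ , λ₂ , λ₃ , λ₁∈Fq , λ₂∈Fq , λ₃∈Fq , not-all-zero , rel) = by-cases (λ₁ ≟ 0#) (λ₂ ≟ 0#) (λ₃ ≟ 0#)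
      where
      P₁ = vpt F q ω₁ x₁
      P₂ = vpt F q ω₂ x₂
      P₃ = vpt F q ω₃ x₃
      λ₁-fixed = InFq⇒Fixed λ₁∈Fq
      λ₂-fixed = InFq⇒Fixed λ₂∈Fq
      λ₃-fixed = InFq⇒Fixed λ₃∈Fq
      coord≉0 : ∀ {x} → x ≉ 0# → pow F x 2 ≉ 0#
      coord≉0 x≉0 = *-nonzero x≉0 x≉0 ∘ trans (sym (pow-2 _))
      by-cases : Dec (λ₁ ≈ 0#) → Dec (λ₂ ≈ 0#) → Dec (λ₃ ≈ 0#) → ⊥
      by-cases (yes λ₁≈0) _ _ =
        not-all-zero (λ₁≈0 , independent₂ P₂ P₃ ¬P₂P₃ (coord≉0 x₂≉0) (coord≉0 x₃≉0) λ₂-fixed λ₃-fixed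
                               (LinearRelation₃-drop P₂ P₃ P₁ λ₁≈0 (LinearRelation₃-rotate P₁ P₂ P₃ rel)))
      by-cases (no _) (yes λ₂≈0) _ =
        let λ₁≈0 , λ₃≈0 = independent₂ P₁ P₃ ¬P₁P₃ (coord≉0 x₁≉0) (coord≉0 x₃≉0) λ₁-fixed λ₃-fixed
                            (LinearRelation₃-drop P₁ P₃ P₂ λ₂≈0 (LinearRelation₃-swap P₁ P₂ P₃ rel))
        in not-all-zero (λ₁≈0 , λ₂≈0 , λ₃≈0)
      by-cases (no _) (no _) (yes λ₃≈0) =
        let λ₁≈0 , λ₂≈0 = independent₂ P₁ P₂ ¬P₁P₂ (coord≉0 x₁≉0) (coord≉0 x₂≉0) λ₁-fixed λ₂-fixed
                            (LinearRelation₃-drop P₁ P₂ P₃ λ₃≈0 rel)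
        in not-all-zero (λ₁≈0 , λ₂≈0 , λ₃≈0)
      by-cases (no λ₁≉0) (no λ₂≉0) (no λ₃≉0) =
        Sum.[ ¬P₁P₂ , Sum.[ ¬P₁P₃ , ¬P₂P₃ ] ] (two-points-coincide λ₁-fixed λ₂-fixed λ₃-fixed λ₁≉0 λ₂≉0 λ₃≉0
                                                 x₁≉0 x₂≉0 x₃≉0 ω₁-weight ω₂-weight ω₃-weight rel)

open import Level using (Level)
open import Data.Nat using (ℕ; _<_; _≤_; _+_; _*_; _^_)
open import Data.Nat.Divisibility using (_∣_)
open import Data.Fin using (Fin)
open import Data.Product using (_×_)
open import Data.Sum using (_⊎_)
open import Relation.Nullary using (¬_)
open import Relation.Binary.PropositionalEquality using (setoid)
open import Function.Bundles using (Bijection)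
open import Algebra.Bundles using (CommutativeRing)

proposition3p5 : ∀ {c ℓ : Level} (q n : ℕ) → IsPrimePower q → 2 < q → 1 ≤ n →
  (F : CommutativeRing c ℓ) → IsField F →
  Bijection (setoid (Fin (q ^ (2 * n + 1)))) (CommutativeRing.setoid F) →
  (α : CommutativeRing.Carrier F) → InFq F q α →
  ¬ (CommutativeRing._≈_ F α (CommutativeRing.0# F)) →
  ¬ (CommutativeRing._≈_ F α (CommutativeRing.1# F)) →
  (¬ (2 ∣ q) → CommutativeRing._≈_ F α (CommutativeRing.-_ F (CommutativeRing.1# F))) →
  ∀ (x₁ x₂ x₃ ω₁ ω₂ ω₃ : CommutativeRing.Carrier F) →
  ¬ (CommutativeRing._≈_ F x₁ (CommutativeRing.0# F)) →
  ¬ (CommutativeRing._≈_ F x₂ (CommutativeRing.0# F)) →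
  ¬ (CommutativeRing._≈_ F x₃ (CommutativeRing.0# F)) →
  (CommutativeRing._≈_ F ω₁ (CommutativeRing.1# F) ⊎ CommutativeRing._≈_ F ω₁ α) →
  (CommutativeRing._≈_ F ω₂ (CommutativeRing.1# F) ⊎ CommutativeRing._≈_ F ω₂ α) →
  (CommutativeRing._≈_ F ω₃ (CommutativeRing.1# F) ⊎ CommutativeRing._≈_ F ω₃ α) →
  ¬ SamePoint F q (vpt F q ω₁ x₁) (vpt F q ω₂ x₂) →
  ¬ SamePoint F q (vpt F q ω₁ x₁) (vpt F q ω₃ x₃) →
  ¬ SamePoint F q (vpt F q ω₂ x₂) (vpt F q ω₃ x₃) →
  ¬ FqDependent3 F q (vpt F q ω₁ x₁) (vpt F q ω₂ x₂) (vpt F q ω₃ x₃)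
proposition3p5 q n (p , k , p-prime , _ , q≡pᵏ) _ _ F isField enumeration α α∈Fq α≉0 _ odd⇒α≈-1 _ _ _ _ _ _ =
  cap (InFq⇒Fixed α∈Fq) α≉0 (char-2-or-square≈1 odd⇒α≈-1)
  where
  open FieldOfPrimePowerOrder F isField p-prime k q≡pᵏ (2 * n + 1) enumeration
  open Cap F isField _≟_ q σ-homo-+ n x^N≈x using (InFq⇒Fixed; cap)
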